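{- Let $m>1$ be even and $n\in\mathbb N_0$, and write $n=a_0+a_1m+\dots+a_sm^s$ with $1\le a_j\le m-1$ for $j=0,\dots,s$. Then $$\overline{b}_m(mn)\equiv\prod_{j=0}^{s}(2a_j+1)\pmod{2m}.$$
   Context: The sequence $(\overline{b}_m(n))_{n\in\mathbb N_0}$ is defined by $\overline{b}_m(0)=1$, $\overline{b}_m(mn)=\overline{b}_m(mn+1)=\dots=\overline{b}_m(mn+m-1)$ for $n\ge0$, and $\overline{b}_m(mn)-\overline{b}_m(mn-1)=\overline{b}_m(n)+\overline{b}_m(n-1)$ for $n\ge1$. -}

module Defs where

open import Data.Nat using (ℕ; zero; suc; _+_; _*_; _∸_; _≤_; _<_)
open import Data.List using (List; foldr; map)
open import Data.Nat.ListAction using (product)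
open import Data.Product using (_×_)
open import Relation.Binary.PropositionalEquality using (_≡_)

-- f is the sequence \overline{b}_m, characterised exactly by the defining equations:
--   b(0) = 1,
--   b(mn) = b(mn+1) = ... = b(mn+m-1)     (n ≥ 0),
--   b(mn) - b(mn-1) = b(n) + b(n-1)        (n ≥ 1).
-- (The sequence is nondecreasing and ℕ-valued, so the difference equation is
--  stated additively.)
IsBbar : ℕ → (ℕ → ℕ) → Set
IsBbar m b =
  (b 0 ≡ 1)
  × (∀ n r → r < m → b (m * n + r) ≡ b (m * n))
  × (∀ n → 1 ≤ n → b (m * n) ≡ b (m * n ∸ 1) + (b n + b (n ∸ 1)))

fromDigits : ℕ → List ℕ → ℕ
fromDigits m = foldr (λ a acc → a + m * acc) 0

digitProduct : List ℕ → ℕ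
digitProduct ds = product (map (λ a → 2 * a + 1) ds)

{-# OPTIONS --safe #-}
-- Write c(q) = b(mq). Within a block b is constant, so the difference equation gives
-- c(mq + r) = c(mq) + 2r c(q) for r < m; running it across whole blocks yields the exact
-- identity c(mp) = c(p) + 2m (c(0) + … + c(p − 1)). Hence c(a + mr) ≡ (2a + 1) c(r)
-- (mod 2m) for every digit a, and induction on the digits gives the product.
module Submission where

open import Defs
open import Data.Nat using (ℕ; zero; suc; _+_; _*_; _∸_; _≤_; _<_; s≤s; z≤n)
open import Data.Nat.Properties
  using (+-suc; +-comm; +-identityʳ; *-zeroʳ; n<1+n; <-trans; m≤m+n; m+n∸m≡n)
open import Data.Nat.Divisibility using (_∣_; m∣m*n)
open import Data.Nat.Solver using (module +-*-Solver)
open import Data.Integer using (+_; _-_; ∣_∣; _⊖_)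
open import Data.Integer.Properties using ([+m]-[+n]≡m⊖n; ∣m⊖n∣≡∣n⊖m∣; ∣⊖∣-≤)
import Data.Integer.Divisibility as ℤ
open import Data.List using (List; []; _∷_)
open import Data.List.Relation.Unary.All as All using (All; []; _∷_)
open import Data.Product using (_×_; _,_; proj₁; proj₂; ∃-syntax)
open import Relation.Binary.PropositionalEquality
  using (_≡_; refl; sym; trans; cong; cong₂; subst; module ≡-Reasoning)

open +-*-Solver
open ≡-Reasoning

∣[x+y]-x∣≡y : ∀ x y → ∣ + (x + y) - + x ∣ ≡ y
∣[x+y]-x∣≡y x y = begin
  ∣ + (x + y) - + x ∣ ≡⟨ cong ∣_∣ ([+m]-[+n]≡m⊖n (x + y) x) ⟩
  ∣ (x + y) ⊖ x ∣     ≡⟨ ∣m⊖n∣≡∣n⊖m∣ (x + y) x ⟩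
  ∣ x ⊖ (x + y) ∣     ≡⟨ ∣⊖∣-≤ (m≤m+n x y) ⟩
  (x + y) ∸ x         ≡⟨ m+n∸m≡n x y ⟩
  y                   ∎

∣⇒∣[x+y]-x : ∀ {d} x {y} → d ∣ y → (+ d) ℤ.∣ (+ (x + y) - + x)
∣⇒∣[x+y]-x {d} x {y} = subst (d ∣_) (sym (∣[x+y]-x∣≡y x y))

module Bbar (k : ℕ) (b : ℕ → ℕ) (isBbar : IsBbar (suc k) b) where

  private
    m : ℕ
    m = suc k

  b-block : ∀ q r → r < m → b (m * q + r) ≡ b (m * q)
  b-block = proj₁ (proj₂ isBbar)

  b-last : ∀ q → b (m * q + k) ≡ b (m * q)
  b-last q = b-block q k (n<1+n k)

  m*[1+q]≡1+[m*q+k] : ∀ q → m * suc q ≡ suc (m * q + k)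
  m*[1+q]≡1+[m*q+k] q =
    solve 2 (λ q k → (con 1 :+ k) :* (con 1 :+ q) := con 1 :+ ((con 1 :+ k) :* q :+ k)) refl q k

  bm : ℕ → ℕ
  bm q = b (m * q)

  bm-sum : ℕ → ℕ
  bm-sum zero    = 0
  bm-sum (suc p) = bm-sum p + bm p

  bm-0 : bm 0 ≡ 1
  bm-0 = trans (cong b (*-zeroʳ m)) (proj₁ isBbar)

  bm-suc : ∀ q → bm (suc q) ≡ bm q + (b (suc q) + b q)
  bm-suc q = begin
    bm (suc q)
      ≡⟨ proj₂ (proj₂ isBbar) (suc q) (s≤s z≤n) ⟩
    b (m * suc q ∸ 1) + (b (suc q) + b q)
      ≡⟨ cong (λ i → b (i ∸ 1) + (b (suc q) + b q)) (m*[1+q]≡1+[m*q+k] q) ⟩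
    b (m * q + k) + (b (suc q) + b q)
      ≡⟨ cong (_+ (b (suc q) + b q)) (b-last q) ⟩
    bm q + (b (suc q) + b q) ∎

  bm-in-block : ∀ q r → r < m → bm (m * q + r) ≡ bm (m * q) + r * (2 * bm q)
  bm-in-block q zero    _     = trans (cong bm (+-identityʳ (m * q))) (sym (+-identityʳ _))
  bm-in-block q (suc r) 1+r<m = begin
    bm (m * q + suc r)
      ≡⟨ cong bm (+-suc (m * q) r) ⟩
    bm (suc (m * q + r))
      ≡⟨ bm-suc (m * q + r) ⟩
    bm (m * q + r) + (b (suc (m * q + r)) + b (m * q + r))
      ≡⟨ cong₂ (λ x y → bm (m * q + r) + (x + y)) b-next (b-block q r r<m) ⟩
    bm (m * q + r) + (bm q + bm q)
      ≡⟨ cong (_+ (bm q + bm q)) (bm-in-block q r r<m) ⟩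
    bm (m * q) + r * (2 * bm q) + (bm q + bm q)
      ≡⟨ solve 3 (λ x r y → x :+ r :* (con 2 :* y) :+ (y :+ y) := x :+ (con 1 :+ r) :* (con 2 :* y))
           refl (bm (m * q)) r (bm q) ⟩
    bm (m * q) + suc r * (2 * bm q) ∎
    where
    r<m : r < m
    r<m = <-trans (n<1+n r) 1+r<m
    b-next : b (suc (m * q + r)) ≡ bm q
    b-next = trans (cong b (sym (+-suc (m * q) r))) (b-block q (suc r) 1+r<m)

  bm-scale : ∀ p → bm (m * p) ≡ bm p + 2 * m * bm-sum p
  bm-scale zero = begin
    bm (m * 0)              ≡⟨ +-identityʳ (bm (m * 0)) ⟨
    bm (m * 0) + 0          ≡⟨ cong₂ _+_ (cong bm (*-zeroʳ m)) (sym (*-zeroʳ (2 * m))) ⟩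
    bm 0 + 2 * m * bm-sum 0 ∎
  bm-scale (suc p) = begin
    bm (m * suc p)
      ≡⟨ cong bm (m*[1+q]≡1+[m*q+k] p) ⟩
    bm (suc (m * p + k))
      ≡⟨ bm-suc (m * p + k) ⟩
    bm (m * p + k) + (b (suc (m * p + k)) + b (m * p + k))
      ≡⟨ cong₂ (λ i x → bm (m * p + k) + (b i + x)) (sym (m*[1+q]≡1+[m*q+k] p)) (b-last p) ⟩
    bm (m * p + k) + (bm (suc p) + bm p)
      ≡⟨ cong (_+ (bm (suc p) + bm p)) (bm-in-block p k (n<1+n k)) ⟩
    bm (m * p) + k * (2 * bm p) + (bm (suc p) + bm p)
      ≡⟨ cong (λ x → x + k * (2 * bm p) + (bm (suc p) + bm p)) (bm-scale p) ⟩
    bm p + 2 * m * bm-sum p + k * (2 * bm p) + (bm (suc p) + bm p)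
      ≡⟨ solve 4 (λ y s k z → y :+ con 2 :* (con 1 :+ k) :* s :+ k :* (con 2 :* y) :+ (z :+ y)
                             := z :+ con 2 :* (con 1 :+ k) :* (s :+ y))
           refl (bm p) (bm-sum p) k (bm (suc p)) ⟩
    bm (suc p) + 2 * m * bm-sum (suc p) ∎

  bm-digit : ∀ a r → a < m → bm (a + m * r) ≡ (2 * a + 1) * bm r + 2 * m * bm-sum r
  bm-digit a r a<m = begin
    bm (a + m * r)                              ≡⟨ cong bm (+-comm a (m * r)) ⟩
    bm (m * r + a)                              ≡⟨ bm-in-block r a a<m ⟩
    bm (m * r) + a * (2 * bm r)                 ≡⟨ cong (_+ a * (2 * bm r)) (bm-scale r) ⟩
    bm r + 2 * m * bm-sum r + a * (2 * bm r)
      ≡⟨ solve 4 (λ y t a s → y :+ t :* s :+ a :* (con 2 :* y) := (con 2 :* a :+ con 1) :* y :+ t :* s)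
           refl (bm r) (2 * m) a (bm-sum r) ⟩
    (2 * a + 1) * bm r + 2 * m * bm-sum r       ∎

  bm-fromDigits : ∀ {ds} → All (_< m) ds → ∃[ t ] bm (fromDigits m ds) ≡ digitProduct ds + 2 * m * t
  bm-fromDigits []                   = 0 , trans bm-0 (sym (cong suc (*-zeroʳ (2 * m))))
  bm-fromDigits {a ∷ ds} (a<m ∷ ds<m) with bm-fromDigits ds<m
  ... | t , bm-r≡ = (2 * a + 1) * t + bm-sum r , (begin
    bm (a + m * r)
      ≡⟨ bm-digit a r a<m ⟩
    (2 * a + 1) * bm r + 2 * m * bm-sum r
      ≡⟨ cong (λ x → (2 * a + 1) * x + 2 * m * bm-sum r) bm-r≡ ⟩
    (2 * a + 1) * (P + 2 * m * t) + 2 * m * bm-sum r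
      ≡⟨ solve 5 (λ c P t' t s → c :* (P :+ t' :* t) :+ t' :* s := c :* P :+ t' :* (c :* t :+ s))
           refl (2 * a + 1) P (2 * m) t (bm-sum r) ⟩
    (2 * a + 1) * P + 2 * m * ((2 * a + 1) * t + bm-sum r) ∎)
    where
    r P : ℕ
    r = fromDigits m ds
    P = digitProduct ds

corollary8 : (m : ℕ) → 1 < m → 2 ∣ m → (b : ℕ → ℕ) → IsBbar m b →
    (n : ℕ) (ds : List ℕ) → All (λ a → 1 ≤ a × a ≤ m ∸ 1) ds → n ≡ fromDigits m ds →
    (+ (2 * m)) ℤ.∣ (+ b (m * n) - + digitProduct ds)
corollary8 zero    ()
corollary8 (suc k) _ _ b isBbar n ds digits refl
  with bm-fromDigits (All.map (λ (_ , a≤k) → s≤s a≤k) digits)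
  where open Bbar k b isBbar
... | t , bmn≡ = subst (λ x → (+ (2 * suc k)) ℤ.∣ (+ x - + digitProduct ds)) (sym bmn≡)
                   (∣⇒∣[x+y]-x (digitProduct ds) (m∣m*n t))
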